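{- Let $n\ge 2$ and consider a partial coloring of an $n\times n$ square $A$ with colors from $\{1,2,\dots,2n-2\}$. If this partial coloring uniquely extends to $L(n,2n-2)$, then $A$ has no three uncolored entries in the same row, and no three uncolored entries in the same column.
   Context: An $L(n,k)$ is an $n\times n$ square all of whose entries are colored with colors from a set of $k$ colors so that all entries in a common row, and all entries in a common column, have pairwise different colors. A partial coloring of an $n\times n$ square assigns colors (from the $k$ colors) to some of its entries; the remaining entries are called uncolored. A partial coloring uniquely extends to $L(n,k)$ if there is exactly one way to color the uncolored entries so that the resulting fully colored square is an $L(n,k)$. -}

module Defs where

open import Data.Nat using (ℕ; _+_; _*_; _∸_)
open import Data.Fin using (Fin)
open import Data.Maybe using (Maybe; just; nothing)
open import Data.Product using (Σ; _×_; ∃)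
open import Relation.Binary.PropositionalEquality using (_≡_; _≢_)

-- A partial coloring of an n×n square with colors from a k-element set
-- (colors represented as Fin k); `nothing` = uncolored entry.
PartialColoring : ℕ → ℕ → Set
PartialColoring n k = Fin n → Fin n → Maybe (Fin k)

Coloring : ℕ → ℕ → Set
Coloring n k = Fin n → Fin n → Fin k

IsL : ∀ {n k} → Coloring n k → Set
IsL {n} C =
  (∀ (i j j' : Fin n) → j ≢ j' → C i j ≢ C i j') ×
  (∀ (i i' j : Fin n) → i ≢ i' → C i j ≢ C i' j)

Extends : ∀ {n k} → Coloring n k → PartialColoring n k → Set
Extends {n} {k} C P = ∀ (i j : Fin n) (c : Fin k) → P i j ≡ just c → C i j ≡ c

UniquelyExtends : ∀ {n k} → PartialColoring n k → Set
UniquelyExtends {n} {k} P =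
  Σ (Coloring n k) (λ C → IsL C × Extends C P ×
     (∀ (C' : Coloring n k) → IsL C' → Extends C' P → ∀ (i j : Fin n) → C' i j ≡ C i j))

ThreeUncoloredInRow : ∀ {n k} → PartialColoring n k → Fin n → Set
ThreeUncoloredInRow {n} P i =
  Σ (Fin n) λ a → Σ (Fin n) λ b → Σ (Fin n) λ c →
    a ≢ b × a ≢ c × b ≢ c ×
    P i a ≡ nothing × P i b ≡ nothing × P i c ≡ nothing

ThreeUncoloredInCol : ∀ {n k} → PartialColoring n k → Fin n → Set
ThreeUncoloredInCol {n} P j =
  Σ (Fin n) λ a → Σ (Fin n) λ b → Σ (Fin n) λ c →
    a ≢ b × a ≢ c × b ≢ c ×
    P a j ≡ nothing × P b j ≡ nothing × P c j ≡ nothing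

module Submission where

-- Let C be the unique completion and (i,a), (i,b), (i,c) uncoloured. For each
-- x ∈ {a,b,c} at most n + (n − 3) colours occur in column x or in row i off
-- {a,b,c}, so since k ≥ 2n − 2 some colour d occurs in neither. Writing d into
-- (i,x) would give a second completion, so d is the colour of one of the other
-- two uncoloured cells of the row. This defines a fixed-point-free map on
-- {a,b,c} along which colours can move without column clashes; it contains a
-- 2-cycle or a 3-cycle, and permuting row i along it gives a second completion.
-- Columns follow by transposing the square.

open import Defs
open import Data.Nat using (ℕ; _≤_; _<_; _+_; _∸_; s≤s)
open import Data.Nat.Properties using (≤⇒≯; ≤-trans; ≤-reflexive; +-suc; m≤m+n; m∸n+n≡m)
open import Data.Fin using (Fin; zero; suc; join; splitAt)
open import Data.Fin.Properties using (_≟_; any?; all?; injective⇒≤; splitAt-join; join-splitAt)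
open import Data.Fin.Permutation using (Permutation′; _⟨$⟩ʳ_; _⟨$⟩ˡ_; inverseˡ; transpose; _∘ₚ_)
import Data.Fin.Permutation.Components as PC
open import Data.Maybe using (just; nothing)
open import Data.Product using (∃; _×_; _,_; proj₁; proj₂)
open import Data.Sum using (_⊎_; inj₁; inj₂; [_,_]′; map)
open import Data.Sum.Properties using (inj₂-injective)
open import Data.Empty using (⊥; ⊥-elim)
open import Function using (_∘_; flip)
open import Data.Vec.Functional using (updateAt; []; _∷_)
open import Data.Vec.Functional.Properties using (updateAt-updates; updateAt-minimal)
open import Function.Definitions using (Injective)
open import Relation.Binary.PropositionalEquality
open import Relation.Nullary using (¬_; yes; no; contradiction)
open import Relation.Nullary.Decidable using (¬?; _×-dec_; _→-dec_)

join-injective : ∀ m n → Injective _≡_ _≡_ (join m n)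
join-injective m n {u} {v} e =
  trans (sym (splitAt-join m n u)) (trans (cong (splitAt m) e) (splitAt-join m n v))

disjoint-injective⇒≤ : ∀ {m j N} {f : Fin m → Fin N} {g : Fin j → Fin N} →
  Injective _≡_ _≡_ f → Injective _≡_ _≡_ g → (∀ x y → f x ≢ g y) → m + j ≤ N
disjoint-injective⇒≤ {m} {j} {f = f} {g} f-inj g-inj disjoint =
  injective⇒≤ (λ e → splitAt-injective ([f,g]-injective e))
  where
  [f,g]-injective : Injective _≡_ _≡_ [ f , g ]′
  [f,g]-injective {inj₁ x} {inj₁ y} e = cong inj₁ (f-inj e)
  [f,g]-injective {inj₁ x} {inj₂ y} e = contradiction e (disjoint x y)
  [f,g]-injective {inj₂ x} {inj₁ y} e = contradiction (sym e) (disjoint y x)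
  [f,g]-injective {inj₂ x} {inj₂ y} e = cong inj₂ (g-inj e)
  splitAt-injective : Injective _≡_ _≡_ (splitAt m {j})
  splitAt-injective {x} {y} e =
    trans (sym (join-splitAt m j x)) (trans (cong (join m j) e) (join-splitAt m j y))

all-values-occur⇒≤ : ∀ {n k j} (f g : Fin n → Fin k) (u : Fin j → Fin n) → Injective _≡_ _≡_ u →
  (∀ d → ¬ ((∀ r → f r ≢ d) × (∀ y → (∀ z → u z ≢ y) → g y ≢ d))) → k + j ≤ n + n
all-values-occur⇒≤ {n} {k} {j} f g u u-inj none =
  disjoint-injective⇒≤ witness-injective excluded-injective witness-not-excluded
  where
  occurrence : ∀ d → ∃ λ p → [ f , g ]′ p ≡ d × ∀ z → p ≢ inj₂ (u z)
  occurrence d with any? (λ r → f r ≟ d)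
  ... | yes (r , fr≡d) = inj₁ r , fr≡d , λ _ ()
  ... | no notInF with any? (λ y → all? (λ z → ¬? (u z ≟ y)) ×-dec g y ≟ d)
  ...   | yes (y , y∉u , gy≡d) = inj₂ y , gy≡d , λ z e → y∉u z (sym (inj₂-injective e))
  ...   | no notInG = ⊥-elim (none d ((λ r e → notInF (r , e)) , λ y y∉u e → notInG (y , y∉u , e)))
  position : Fin k → Fin n ⊎ Fin n
  position d = proj₁ (occurrence d)
  witness : Fin k → Fin (n + n)
  witness d = join n n (position d)
  excluded : Fin j → Fin (n + n)
  excluded z = join n n (inj₂ (u z))
  witness-injective : Injective _≡_ _≡_ witness
  witness-injective {d} {d′} e =
    trans (sym (proj₁ (proj₂ (occurrence d))))
          (trans (cong [ f , g ]′ (join-injective n n {position d} {position d′} e))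
                 (proj₁ (proj₂ (occurrence d′))))
  excluded-injective : Injective _≡_ _≡_ excluded
  excluded-injective = u-inj ∘ inj₂-injective ∘ join-injective n n
  witness-not-excluded : ∀ d z → witness d ≢ excluded z
  witness-not-excluded d z = proj₂ (proj₂ (occurrence d)) z ∘ join-injective n n {position d}

missing-value : ∀ {n k j} (f g : Fin n → Fin k) (u : Fin j → Fin n) → Injective _≡_ _≡_ u →
  n + n < k + j → ∃ λ d → (∀ r → f r ≢ d) × (∀ y → (∀ z → u z ≢ y) → g y ≢ d)
missing-value f g u u-inj n+n<k+j
  with any? (λ d → all? (λ r → ¬? (f r ≟ d)) ×-dec
                   all? (λ y → all? (λ z → ¬? (u z ≟ y)) →-dec ¬? (g y ≟ d)))
... | yes found = found
... | no none = contradiction n+n<k+j (≤⇒≯ (all-values-occur⇒≤ f g u u-inj (λ d m → none (d , m))))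

triple-injective : ∀ {A : Set} {x y z : A} → x ≢ y → x ≢ z → y ≢ z → Injective _≡_ _≡_ (x ∷ y ∷ z ∷ [])
triple-injective _ _ _ {zero} {zero} _ = refl
triple-injective x≢y _ _ {zero} {suc zero} e = contradiction e x≢y
triple-injective _ x≢z _ {zero} {suc (suc zero)} e = contradiction e x≢z
triple-injective x≢y _ _ {suc zero} {zero} e = contradiction (sym e) x≢y
triple-injective _ _ _ {suc zero} {suc zero} _ = refl
triple-injective _ _ y≢z {suc zero} {suc (suc zero)} e = contradiction e y≢z
triple-injective _ x≢z _ {suc (suc zero)} {zero} e = contradiction (sym e) x≢z
triple-injective _ _ y≢z {suc (suc zero)} {suc zero} e = contradiction (sym e) y≢z
triple-injective _ _ _ {suc (suc zero)} {suc (suc zero)} _ = refl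

module _ {n : ℕ} (i j : Fin n) where

  transpose-matchˡ : PC.transpose i j i ≡ j
  transpose-matchˡ with i ≟ i
  ... | yes _ = refl
  ... | no i≢i = contradiction refl i≢i

  transpose-matchʳ : PC.transpose i j j ≡ i
  transpose-matchʳ with j ≟ i
  ... | yes refl = refl
  ... | no _ with j ≟ j
  ...   | yes _ = refl
  ...   | no j≢j = contradiction refl j≢j

  transpose-mismatch : ∀ {y} → y ≢ i → y ≢ j → PC.transpose i j y ≡ y
  transpose-mismatch {y} y≢i y≢j with y ≟ i
  ... | yes y≡i = contradiction y≡i y≢i
  ... | no _ with y ≟ j
  ...   | yes y≡j = contradiction y≡j y≢j
  ...   | no _ = refl

  transpose-moved : ∀ {y} → PC.transpose i j y ≢ y → y ≡ i ⊎ y ≡ j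
  transpose-moved {y} moves with y ≟ i
  ... | yes y≡i = inj₁ y≡i
  ... | no _ with y ≟ j
  ...   | yes y≡j = inj₂ y≡j
  ...   | no _ = contradiction refl moves

∘ₚ-moved : ∀ {n} (π ρ : Permutation′ n) {y} → (π ∘ₚ ρ) ⟨$⟩ʳ y ≢ y → π ⟨$⟩ʳ y ≢ y ⊎ ρ ⟨$⟩ʳ y ≢ y
∘ₚ-moved π ρ {y} moves with π ⟨$⟩ʳ y ≟ y
... | yes πy≡y = inj₂ (moves ∘ trans (cong (ρ ⟨$⟩ʳ_) πy≡y))
... | no πy≢y = inj₁ πy≢y

IsL-flip : ∀ {n k} {C : Coloring n k} → IsL C → IsL (flip C)
IsL-flip (rows , columns) = (λ r y y′ → columns y y′ r) , (λ r r′ y → rows y r r′)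

Extends-flip : ∀ {n k} {C : Coloring n k} {P : PartialColoring n k} → Extends C P → Extends (flip C) (flip P)
Extends-flip E r y = E y r

UniquelyExtends-flip : ∀ {n k} {P : PartialColoring n k} → UniquelyExtends P → UniquelyExtends (flip P)
UniquelyExtends-flip (C , L , E , unique) =
  flip C , IsL-flip L , Extends-flip E ,
  λ C′ L′ E′ r y → unique (flip C′) (IsL-flip L′) (Extends-flip E′) y r

module UniqueExtensionRow {n k} {P : PartialColoring n k} (ue : UniquelyExtends P) (i : Fin n) where

  C : Coloring n k
  C = proj₁ ue

  C-IsL : IsL C
  C-IsL = proj₁ (proj₂ ue)

  C-extends : Extends C P
  C-extends = proj₁ (proj₂ (proj₂ ue))

  C-unique : ∀ C′ → IsL C′ → Extends C′ P → ∀ r y → C′ r y ≡ C r y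
  C-unique = proj₂ (proj₂ (proj₂ ue))

  row-injective : Injective _≡_ _≡_ (C i)
  row-injective {y} {z} e with y ≟ z
  ... | yes y≡z = y≡z
  ... | no y≢z = contradiction e (proj₁ C-IsL i y z y≢z)

  ColumnLacks : Fin n → Fin k → Set
  ColumnLacks x d = ∀ r → C r x ≢ d

  recolouring-trivial : (new : Fin n → Fin k) → Injective _≡_ _≡_ new →
    (∀ y c → P i y ≡ just c → new y ≡ C i y) → (∀ r y → r ≢ i → C r y ≢ new y) →
    ∀ y → new y ≡ C i y
  recolouring-trivial new new-injective keeps-colours no-clash y =
    trans (sym (cong-app C′ᵢ≡new y)) (C-unique C′ (rows , columns) extends i y)
    where
    C′ : Coloring n k
    C′ = updateAt C i (λ _ → new)
    C′ᵢ≡new : C′ i ≡ new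
    C′ᵢ≡new = updateAt-updates i C
    C′ᵣ≡Cᵣ : ∀ {r} → r ≢ i → C′ r ≡ C r
    C′ᵣ≡Cᵣ {r} = updateAt-minimal r i C
    rows : ∀ r y y′ → y ≢ y′ → C′ r y ≢ C′ r y′
    rows r y y′ y≢y′ with r ≟ i
    ... | yes refl rewrite C′ᵢ≡new = y≢y′ ∘ new-injective
    ... | no r≢i rewrite C′ᵣ≡Cᵣ r≢i = proj₁ C-IsL r y y′ y≢y′
    columns : ∀ r r′ y → r ≢ r′ → C′ r y ≢ C′ r′ y
    columns r r′ y r≢r′ with r ≟ i | r′ ≟ i
    ... | yes refl | yes refl = contradiction refl r≢r′
    ... | yes refl | no r′≢i rewrite C′ᵢ≡new | C′ᵣ≡Cᵣ r′≢i = no-clash r′ y r′≢i ∘ sym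
    ... | no r≢i | yes refl rewrite C′ᵢ≡new | C′ᵣ≡Cᵣ r≢i = no-clash r y r≢i
    ... | no r≢i | no r′≢i rewrite C′ᵣ≡Cᵣ r≢i | C′ᵣ≡Cᵣ r′≢i = proj₂ C-IsL r r′ y r≢r′
    extends : Extends C′ P
    extends r y c Pry≡c with r ≟ i
    ... | yes refl rewrite C′ᵢ≡new = trans (keeps-colours y c Pry≡c) (C-extends r y c Pry≡c)
    ... | no r≢i rewrite C′ᵣ≡Cᵣ r≢i = C-extends r y c Pry≡c

  permutation-trivial : (σ : Permutation′ n) →
    (∀ y → σ ⟨$⟩ʳ y ≢ y → P i y ≡ nothing × ColumnLacks y (C i (σ ⟨$⟩ʳ y))) →
    ∀ y → σ ⟨$⟩ʳ y ≡ y
  permutation-trivial σ moved y =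
    row-injective (recolouring-trivial (C i ∘ (σ ⟨$⟩ʳ_)) (σ-injective ∘ row-injective) keeps no-clash y)
    where
    σ-injective : Injective _≡_ _≡_ (σ ⟨$⟩ʳ_)
    σ-injective e = trans (sym (inverseˡ σ)) (trans (cong (σ ⟨$⟩ˡ_) e) (inverseˡ σ))
    keeps : ∀ y c → P i y ≡ just c → C i (σ ⟨$⟩ʳ y) ≡ C i y
    keeps y c Piy≡c with σ ⟨$⟩ʳ y ≟ y
    ... | yes σy≡y = cong (C i) σy≡y
    ... | no σy≢y = contradiction (trans (sym Piy≡c) (proj₁ (moved y σy≢y))) λ ()
    no-clash : ∀ r y → r ≢ i → C r y ≢ C i (σ ⟨$⟩ʳ y)
    no-clash r y r≢i with σ ⟨$⟩ʳ y ≟ y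
    ... | yes σy≡y rewrite σy≡y = proj₂ C-IsL r i y r≢i
    ... | no σy≢y = proj₂ (moved y σy≢y) r

  no-swap : ∀ {a b} → a ≢ b → P i a ≡ nothing → P i b ≡ nothing →
    ColumnLacks a (C i b) → ColumnLacks b (C i a) → ⊥
  no-swap {a} {b} a≢b Pa Pb a-lacks-b b-lacks-a =
    a≢b (trans (sym (permutation-trivial σ moved a)) (transpose-matchˡ a b))
    where
    σ : Permutation′ n
    σ = transpose a b
    moved : ∀ y → σ ⟨$⟩ʳ y ≢ y → P i y ≡ nothing × ColumnLacks y (C i (σ ⟨$⟩ʳ y))
    moved y σy≢y with transpose-moved a b σy≢y
    ... | inj₁ refl = Pa , subst (ColumnLacks a ∘ C i) (sym (transpose-matchˡ a b)) a-lacks-b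
    ... | inj₂ refl = Pb , subst (ColumnLacks b ∘ C i) (sym (transpose-matchʳ a b)) b-lacks-a

  no-3-cycle : ∀ {a b c} → a ≢ b → a ≢ c → b ≢ c →
    P i a ≡ nothing → P i b ≡ nothing → P i c ≡ nothing →
    ColumnLacks a (C i b) → ColumnLacks b (C i c) → ColumnLacks c (C i a) → ⊥
  no-3-cycle {a} {b} {c} a≢b a≢c b≢c Pa Pb Pc a-lacks-b b-lacks-c c-lacks-a =
    a≢b (trans (sym (permutation-trivial σ moved a)) σa≡b)
    where
    σ : Permutation′ n
    σ = transpose b c ∘ₚ transpose a b
    σa≡b : σ ⟨$⟩ʳ a ≡ b
    σa≡b = trans (cong (PC.transpose a b) (transpose-mismatch b c a≢b a≢c)) (transpose-matchˡ a b)
    σb≡c : σ ⟨$⟩ʳ b ≡ c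
    σb≡c = trans (cong (PC.transpose a b) (transpose-matchˡ b c))
                 (transpose-mismatch a b (a≢c ∘ sym) (b≢c ∘ sym))
    σc≡a : σ ⟨$⟩ʳ c ≡ a
    σc≡a = trans (cong (PC.transpose a b) (transpose-matchʳ b c)) (transpose-matchʳ a b)
    Movable : Fin n → Set
    Movable y = P i y ≡ nothing × ColumnLacks y (C i (σ ⟨$⟩ʳ y))
    movable-a : Movable a
    movable-a = Pa , subst (ColumnLacks a ∘ C i) (sym σa≡b) a-lacks-b
    movable-b : Movable b
    movable-b = Pb , subst (ColumnLacks b ∘ C i) (sym σb≡c) b-lacks-c
    movable-c : Movable c
    movable-c = Pc , subst (ColumnLacks c ∘ C i) (sym σc≡a) c-lacks-a
    moved : ∀ y → σ ⟨$⟩ʳ y ≢ y → Movable y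
    moved y σy≢y with ∘ₚ-moved (transpose b c) (transpose a b) σy≢y
    ... | inj₁ moved-by-bc with transpose-moved b c moved-by-bc
    ...   | inj₁ refl = movable-b
    ...   | inj₂ refl = movable-c
    moved y σy≢y | inj₂ moved-by-ab with transpose-moved a b moved-by-ab
    ...   | inj₁ refl = movable-a
    ...   | inj₂ refl = movable-b

  colour-from-triple : ∀ {x y z d} → P i x ≡ nothing → ColumnLacks x d →
    (∀ w → (∀ t → (x ∷ y ∷ z ∷ []) t ≢ w) → C i w ≢ d) → d ≡ C i y ⊎ d ≡ C i z
  colour-from-triple {x} {y} {z} {d} Px x-lacks-d d∉row with d ≟ C i y | d ≟ C i z
  ... | yes d≡y | _ = inj₁ d≡y
  ... | no _ | yes d≡z = inj₂ d≡z
  ... | no d≢y | no d≢z =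
    ⊥-elim (x-lacks-d i (sym (trans (sym new-x) (recolouring-trivial new new-injective keeps no-clash x))))
    where
    new : Fin n → Fin k
    new = updateAt (C i) x (λ _ → d)
    fresh : ∀ w → w ≢ x → C i w ≢ d
    fresh w w≢x with w ≟ y | w ≟ z
    ... | yes refl | _ = d≢y ∘ sym
    ... | no _ | yes refl = d≢z ∘ sym
    ... | no w≢y | no w≢z = d∉row w λ where
      zero → w≢x ∘ sym
      (suc zero) → w≢y ∘ sym
      (suc (suc zero)) → w≢z ∘ sym
    new-x : new x ≡ d
    new-x = updateAt-updates x (C i)
    new-other : ∀ {w} → w ≢ x → new w ≡ C i w
    new-other {w} = updateAt-minimal w x (C i)
    new-injective : Injective _≡_ _≡_ new
    new-injective {w} {w′} e with w ≟ x | w′ ≟ x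
    ... | yes refl | yes refl = refl
    ... | yes refl | no w′≢x =
      contradiction (sym (trans (sym new-x) (trans e (new-other w′≢x)))) (fresh w′ w′≢x)
    ... | no w≢x | yes refl =
      contradiction (trans (sym (new-other w≢x)) (trans e new-x)) (fresh w w≢x)
    ... | no w≢x | no w′≢x = row-injective (trans (sym (new-other w≢x)) (trans e (new-other w′≢x)))
    keeps : ∀ w c → P i w ≡ just c → new w ≡ C i w
    keeps w c Piw≡c with w ≟ x
    ... | yes refl = contradiction (trans (sym Piw≡c) Px) λ ()
    ... | no w≢x = new-other w≢x
    no-clash : ∀ r w → r ≢ i → C r w ≢ new w
    no-clash r w r≢i with w ≟ x
    ... | yes refl = x-lacks-d r ∘ (λ e → trans e new-x)
    ... | no w≢x = proj₂ C-IsL r i w r≢i ∘ (λ e → trans e (new-other w≢x))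

  uncoloured-fits : n + n ≤ k + 2 → ∀ {x y z} → x ≢ y → x ≢ z → y ≢ z → P i x ≡ nothing →
    ColumnLacks x (C i y) ⊎ ColumnLacks x (C i z)
  uncoloured-fits bound {x} x≢y x≢z y≢z Px
    with missing-value (flip C x) (C i) _ (triple-injective x≢y x≢z y≢z)
           (≤-trans (s≤s bound) (≤-reflexive (sym (+-suc k 2))))
  ... | d , x-lacks-d , d∉row =
    map (λ d≡ → subst (ColumnLacks x) d≡ x-lacks-d) (λ d≡ → subst (ColumnLacks x) d≡ x-lacks-d)
        (colour-from-triple Px x-lacks-d d∉row)

  no-three-uncoloured : n + n ≤ k + 2 → ¬ ThreeUncoloredInRow P i
  no-three-uncoloured bound (a , b , c , a≢b , a≢c , b≢c , Pa , Pb , Pc)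
    with uncoloured-fits bound a≢b a≢c b≢c Pa
       | uncoloured-fits bound (a≢b ∘ sym) b≢c a≢c Pb
       | uncoloured-fits bound (a≢c ∘ sym) (b≢c ∘ sym) a≢b Pc
  ... | inj₁ a←b | inj₁ b←a | _        = no-swap a≢b Pa Pb a←b b←a
  ... | inj₁ a←b | inj₂ b←c | inj₁ c←a = no-3-cycle a≢b a≢c b≢c Pa Pb Pc a←b b←c c←a
  ... | inj₁ _   | inj₂ b←c | inj₂ c←b = no-swap b≢c Pb Pc b←c c←b
  ... | inj₂ a←c | _        | inj₁ c←a = no-swap a≢c Pa Pc a←c c←a
  ... | inj₂ a←c | inj₁ b←a | inj₂ c←b = no-3-cycle a≢c a≢b (b≢c ∘ sym) Pa Pc Pb a←c c←b b←a
  ... | inj₂ _   | inj₂ b←c | inj₂ c←b = no-swap b≢c Pb Pc b←c c←b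

lemma1 : (n : ℕ) → 2 ≤ n → (P : PartialColoring n ((n + n) ∸ 2)) →
    UniquelyExtends P →
    (∀ (i : Fin n) → ¬ ThreeUncoloredInRow P i) × (∀ (j : Fin n) → ¬ ThreeUncoloredInCol P j)
lemma1 n 2≤n P ue =
  (λ i → UniqueExtensionRow.no-three-uncoloured ue i bound) ,
  (λ j → UniqueExtensionRow.no-three-uncoloured (UniquelyExtends-flip ue) j bound)
  where
  bound : n + n ≤ (n + n ∸ 2) + 2
  bound = ≤-reflexive (sym (m∸n+n≡m (≤-trans 2≤n (m≤m+n n n))))
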